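{- Let $G=(V,E,s)$ be a graph in which every node is reachable from $s$, and let its A-C tree map each node $a\in V$ to the sequence $S^a_1,\dots,S^a_{k_a}$ of strongly connected components of $G_a$ in topological order. Then the family of sets $$AC:=\Big\{\{a\}\cup\bigcup_{i=1}^{j} D(S^a_i) : a\in V,\ j\in\{1,\dots,k_a\}\Big\}$$ is a nesting decomposition of $G$ of minimum width, i.e. its width equals the nesting width $\mathrm{nw}(G)$.
   Context: A graph is a tuple $G=(V,E,s)$ with $V$ a finite set of nodes, $E\subseteq V\times V$ a set of arcs and $s\in V$ a source; all nodes are reachable from $s$. Node $a$ dominates node $b$ (written $a\geq_s b$) if every path from $s$ to $b$ contains $a$; this is a partial order whose Hasse diagram (transitive reduction) is a tree rooted at $s$, the dominator tree $T$. For a node $a$, $C(a)$ denotes its children in $T$ and $D(a)$ its descendants in $T$ (including $a$ itself). For each $a$, $G_a$ is the directed graph with node set $C(a)$ and an arc $(u,v)$ whenever $u\neq v$ and there is an arc of $G$ from a node of $D(u)$ to a node of $D(v)$ with both endpoints in $D(a)$ (i.e. in the induced subgraph $G[D(a)]$). The A-C tree of $G$ maps each $a$ to the strongly connected components $S^a_1,\dots,S^a_{k_a}$ of $G_a$ listed in a topological order (a fixed but arbitrary one). For a set $S\subseteq C(a)$, $D(S)=\bigcup_{v\in S}D(v)$. A module of $G$ is a set $M\subseteq V$ having some $m\in M$ such that every arc $(u,v)$ with $u\notin M$, $v\in M$ has $v=m$; by convention a set containing $s$ is a module iff it is a module with source $s$. The trivial modules are $V$ and the singletons $\{v\}$. A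 nesting decomposition of $G$ is a collection of pairwise non-overlapping modules (any two are disjoint or one contains the other) that contains all trivial modules. For a module $M$ in a nesting decomposition $F$, its maximal module partition consists of those $H\in F$ with $H\subsetneq M$ and no $K\in F$ with $H\subsetneq K\subsetneq M$. The width of $F$ is the maximum size of the maximal module partition over modules of $F$; the nesting width $\mathrm{nw}(G)$ is the minimum width over all nesting decompositions of $G$. -}

module Defs where

open import Level using (0ℓ)
open import Data.Nat using (ℕ; _≤_)
open import Data.Fin using (Fin) renaming (_≤_ to _≤ᶠ_)
open import Data.Fin.Subset using (Subset; _∈_; _∉_; _⊆_; _⊂_; ⊤; ⁅_⁆)
open import Data.List using (List; length)
open import Data.List.Membership.Propositional using () renaming (_∈_ to _∈ˡ_)
open import Data.List.Relation.Unary.Unique.Propositional using (Unique)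
open import Data.Product using (Σ; ∃; _×_; _,_)
open import Data.Sum using (_⊎_)
open import Data.Empty using (⊥)
open import Relation.Nullary using (¬_)
open import Relation.Binary.PropositionalEquality using (_≡_; _≢_)
open import Relation.Binary.Construct.Closure.ReflexiveTransitive using (Star)
open import Function.Bundles using (_⇔_)

record Graph : Set₁ where
  field
    n : ℕ
    E : Fin n → Fin n → Set
    s : Fin n

module _ (G : Graph) where
  open Graph G

  data Walk : Fin n → Fin n → Set where
    [] : ∀ {u} → Walk u u
    _∷_ : ∀ {u v w} → E u v → Walk v w → Walk u w

  OnWalk : Fin n → ∀ {u v} → Walk u v → Set
  OnWalk a {u} [] = a ≡ u
  OnWalk a {u} (_ ∷ p) = a ≡ u ⊎ OnWalk a p

  AllReachable : Set
  AllReachable = ∀ v → Walk s v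

  Dom : Fin n → Fin n → Set
  Dom a b = ∀ (p : Walk s b) → OnWalk a p

  StrictDom : Fin n → Fin n → Set
  StrictDom a b = Dom a b × a ≢ b

  -- b ∈ C(a): b is a child of a in the dominator tree (Hasse diagram of ≥_s)
  Child : Fin n → Fin n → Set
  Child a b = StrictDom a b × (∀ c → StrictDom a c → StrictDom c b → ⊥)

  -- x ∈ D(a): descendants of a in the dominator tree (a itself included)
  InD : Fin n → Fin n → Set
  InD a x = Dom a x

  InDS : Subset n → Fin n → Set
  InDS S x = ∃ λ v → v ∈ S × InD v x

  ArcA : Fin n → Fin n → Fin n → Set
  ArcA a u v = Child a u × Child a v × u ≢ v ×
    (∃ λ x → ∃ λ y → InD u x × InD v y × InD a x × InD a y × E x y)

  IsSCC : Fin n → Subset n → Set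
  IsSCC a S = ∃ λ u → Child a u ×
    (∀ v → (v ∈ S) ⇔ (Child a v × Star (ArcA a) u v × Star (ArcA a) v u))

  record IsACTree (k : Fin n → ℕ) (S : (a : Fin n) → Fin (k a) → Subset n) : Set where
    field
      scc   : ∀ a i → IsSCC a (S a i)
      cover : ∀ a v → Child a v → ∃ λ i → v ∈ S a i
      inj   : ∀ a i j → S a i ≡ S a j → i ≡ j
      topo  : ∀ a i j u v → u ∈ S a i → v ∈ S a j → ArcA a u v → i ≤ᶠ j

  -- Modules (with the convention for sets containing s)
  IsModule : Subset n → Set
  IsModule M = ∃ λ m → m ∈ M × (s ∈ M → m ≡ s) ×
    (∀ u v → E u v → u ∉ M → v ∈ M → v ≡ m)

  Family : Set₁
  Family = Subset n → Set

  NonOverlapping : Subset n → Subset n → Set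
  NonOverlapping M N = (∀ x → x ∈ M → x ∈ N → ⊥) ⊎ M ⊆ N ⊎ N ⊆ M

  Trivial : Subset n → Set
  Trivial M = M ≡ ⊤ ⊎ ∃ λ v → M ≡ ⁅ v ⁆

  record IsNestingDecomposition (F : Family) : Set where
    field
      modules     : ∀ M → F M → IsModule M
      nonOverlap  : ∀ M N → F M → F N → NonOverlapping M N
      hasTrivial  : ∀ M → Trivial M → F M

  MaxPart : Family → Subset n → Subset n → Set
  MaxPart F M H = F H × H ⊂ M × (∀ K → F K → H ⊂ K → K ⊂ M → ⊥)

  HasSize : (Subset n → Set) → ℕ → Set
  HasSize P k = Σ (List (Subset n)) λ xs →
    Unique xs × length xs ≡ k × (∀ H → (H ∈ˡ xs) ⇔ P H)

  Width : Family → ℕ → Set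
  Width F w =
    (∀ M → F M → ∃ λ k → HasSize (MaxPart F M) k × k ≤ w) ×
    (∃ λ M → F M × HasSize (MaxPart F M) w)

  NestingWidth : ℕ → Set₁
  NestingWidth w = (∃ λ F → IsNestingDecomposition F × Width F w) ×
    (∀ F w' → IsNestingDecomposition F → Width F w' → w ≤ w')

  -- the family AC (sets {a} ∪ D(S a 0) ∪ … ∪ D(S a j)), together with the trivial modules
  ACSet : (k : Fin n → ℕ) → ((a : Fin n) → Fin (k a) → Subset n) → Subset n → Set
  ACSet k S M = ∃ λ a → ∃ λ (j : Fin (k a)) → ∀ x →
    (x ∈ M) ⇔ (x ≡ a ⊎ (∃ λ i → i ≤ᶠ j × InDS (S a i) x))

  AC : (k : Fin n → ℕ) → ((a : Fin n) → Fin (k a) → Subset n) → Family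
  AC k S M = ACSet k S M ⊎ Trivial M

{-# OPTIONS --safe #-}
-- Each AC set {a} ∪ D(S^a_1) ∪ … ∪ D(S^a_j) is a module entered only at a, because an arc entering
-- D(S^a_i) from another node below a starts under a component listed earlier; and two AC sets are
-- nested or disjoint because the dominators of a node form a chain. The maximal parts of that set
-- are the previous AC set of a and the sets D(v), v ∈ S^a_j, so AC has width max (1 + |S^a_j|).
-- Conversely, in any nesting decomposition take a minimal module M containing a and a node of
-- D(S^a_j). Its entry dominates a, so M contains all of S^a_j, and a and the nodes of S^a_j lie
-- in pairwise different maximal parts of M: M has at least 1 + |S^a_j| of them.
module Submission where

open import Defs
open import Data.Nat using (ℕ)
open import Data.Fin using (Fin)
open import Data.Fin.Subset using (Subset)
open import Data.Product using (_×_; ∃)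

open import Level using (0ℓ)
open import Function using (_∘_; id; flip; _⇔_; mk⇔; Equivalence)
open import Data.Empty using (⊥; ⊥-elim)
open import Data.Sum as Sum using (_⊎_; inj₁; inj₂; [_,_]; [_,_]′)
open import Data.Product using (Σ; _,_; proj₁; proj₂)
open import Data.Nat using (zero; suc; _≤_; _<_; z≤n; s≤s)
import Data.Nat.Properties as ℕₚ
open import Data.Fin using (zero; suc; toℕ; _≟_; fromℕ; fromℕ<)
import Data.Fin.Properties as Finₚ
open import Data.Fin.Subset using (_∈_; _∉_; _⊆_; _⊂_; ⊤; ⁅_⁆)
import Data.Fin.Subset.Properties as Subsetₚ
open import Data.Fin.Subset.Induction using (⊂-wellFounded; ⊃-wellFounded)
open import Data.Fin.Induction using (spo-wellFounded; spo-noetherian)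
import Data.Vec as Vec
import Data.Vec.Properties as Vecₚ
open import Data.List as List using (List; []; _∷_; length; filter; allFin)
import Data.List.Properties as Listₚ
open import Data.List.Membership.Propositional using (_─_; find; lose) renaming (_∈_ to _∈ˡ_)
import Data.List.Membership.Propositional.Properties as ∈ₚ
open import Data.List.Relation.Unary.Any using (Any; here; there; index; any?)
open import Data.List.Relation.Unary.All as All using (All)
open import Data.List.Relation.Unary.AllPairs using ([]; _∷_)
open import Data.List.Relation.Unary.Unique.Propositional using (Unique)
import Data.List.Relation.Unary.Unique.Propositional.Properties as Uniqueₚ
open import Data.List.Extrema ℕₚ.≤-totalOrder using (argmax; f[xs]≤f[argmax])
open import Relation.Nullary using (¬_; Dec; yes; no; does)
open import Relation.Nullary.Negation using (¬¬-map)
open import Relation.Nullary.Decidable using (decidable-stable; dec-true; ¬¬-excluded-middle; map′; _×-dec_; _⊎-dec_; ¬?)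
open import Relation.Unary using (Pred; Decidable)
open import Relation.Binary using (Rel)
open import Relation.Binary.PropositionalEquality using (_≡_; _≢_; refl; sym; trans; cong; subst; isEquivalence)
open import Relation.Binary.Structures using (IsStrictPartialOrder)
open import Relation.Binary.Construct.Closure.ReflexiveTransitive using (Star; ε; _◅_; _◅◅_)
open import Induction.WellFounded using (WellFounded; Acc; acc)

open Equivalence using (to; from)

module _ {a r p} {A : Set a} {_<_ : Rel A r} (wf : WellFounded _<_) {P : Pred A p} where

  wf-minimal : ∀ {x} → P x → ¬ ¬ ∃ λ m → P m × ∀ {y} → P y → ¬ y < m
  wf-minimal = go (wf _)
    where
    go : ∀ {x} → Acc _<_ x → P x → ¬ ¬ ∃ λ m → P m × ∀ {y} → P y → ¬ y < m
    go {x} (acc smaller) px found = ¬¬-excluded-middle {A = ∃ λ y → P y × y < x} λ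
      { (yes (y , py , y<x)) → go (smaller y<x) py found
      ; (no none) → found (x , px , λ py y<x → none (_ , py , y<x)) }

∈-─⁺ : ∀ {A : Set} {x y : A} {xs} (x∈xs : x ∈ˡ xs) → y ∈ˡ xs → y ≢ x → y ∈ˡ xs ─ x∈xs
∈-─⁺ (here refl) (here refl) y≢x = ⊥-elim (y≢x refl)
∈-─⁺ (here _)    (there y∈) _   = y∈
∈-─⁺ (there _)   (here refl) _  = here refl
∈-─⁺ (there x∈)  (there y∈) y≢x = there (∈-─⁺ x∈ y∈ y≢x)

length-≤-by-injection : ∀ {A B : Set} {R : A → B → Set} {ys : List A} (xs : List B) → Unique ys →
                        (∀ {y} → y ∈ˡ ys → ∃ λ x → x ∈ˡ xs × R y x) →
                        (∀ {y y′ x} → y ∈ˡ ys → y′ ∈ˡ ys → R y x → R y′ x → y ≡ y′) →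
                        length ys ≤ length xs
length-≤-by-injection {ys = []} xs _ _ _ = z≤n
length-≤-by-injection {R = R} {ys = y ∷ ys} xs (y∉ys ∷ unique) cover inj
  with x , x∈xs , Ryx ← cover (here refl) =
  ℕₚ.≤-trans (s≤s (length-≤-by-injection (xs ─ x∈xs) unique cover′ (λ p q → inj (there p) (there q))))
             (ℕₚ.≤-reflexive (sym (Listₚ.length-removeAt′ xs (index x∈xs))))
  where
  cover′ : ∀ {y′} → y′ ∈ˡ ys → ∃ λ x′ → x′ ∈ˡ xs ─ x∈xs × R y′ x′
  cover′ y′∈ys with x′ , x′∈xs , Ry′x′ ← cover (there y′∈ys) =
    x′ , ∈-─⁺ x∈xs x′∈xs (λ { refl → All.lookup y∉ys y′∈ys (inj (here refl) (there y′∈ys) Ryx Ry′x′) }) ,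
    Ry′x′

-- Opaque: callers only use the specification, and unfolding the maximiser in their types is very costly.
opaque
  argmax-Fin : ∀ {m} (f : Fin m → ℕ) → Fin m → ∃ λ i → ∀ j → f j ≤ f i
  argmax-Fin {m} f i₀ =
    argmax f i₀ (allFin m) , λ j → All.lookup (f[xs]≤f[argmax] i₀ (allFin m)) (∈ₚ.∈-allFin j)

module _ {m ℓ} {P : Pred (Fin m) ℓ} where

  ⟦_⟧ : Decidable P → Subset m
  ⟦ P? ⟧ = Vec.tabulate (does ∘ P?)

  ∈⟦⟧⁺ : ∀ (P? : Decidable P) {x} → P x → x ∈ ⟦ P? ⟧
  ∈⟦⟧⁺ P? {x} px = Vecₚ.lookup⇒[]= x ⟦ P? ⟧ (trans (Vecₚ.lookup∘tabulate _ x) (dec-true (P? x) px))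

  ∈⟦⟧⁻ : ∀ (P? : Decidable P) {x} → x ∈ ⟦ P? ⟧ → P x
  ∈⟦⟧⁻ P? {x} x∈ with P? x | trans (sym (Vecₚ.[]=⇒lookup x∈)) (Vecₚ.lookup∘tabulate (does ∘ P?) x)
  ... | yes px | _ = px
  ... | no _   | ()

elements : ∀ {m} → Subset m → List (Fin m)
elements {m} p = filter (Subsetₚ._∈? p) (allFin m)

∈-elements⁺ : ∀ {m} {p : Subset m} {x} → x ∈ p → x ∈ˡ elements p
∈-elements⁺ {p = p} {x} = ∈ₚ.∈-filter⁺ (Subsetₚ._∈? p) (∈ₚ.∈-allFin x)

∈-elements⁻ : ∀ {m} {p : Subset m} {x} → x ∈ˡ elements p → x ∈ p
∈-elements⁻ {m} {p} = proj₂ ∘ ∈ₚ.∈-filter⁻ (Subsetₚ._∈? p) {xs = allFin m}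

elements-unique : ∀ {m} (p : Subset m) → Unique (elements p)
elements-unique {m} p = Uniqueₚ.filter⁺ (Subsetₚ._∈? p) (Uniqueₚ.allFin⁺ m)

same-members : ∀ {m ℓ} {p q : Subset m} {Q : Pred (Fin m) ℓ} →
               (∀ x → x ∈ p ⇔ Q x) → (∀ x → x ∈ q ⇔ Q x) → p ≡ q
same-members p⇔ q⇔ = Subsetₚ.⊆-antisym (λ {x} x∈p → from (q⇔ x) (to (p⇔ x) x∈p))
                                        (λ {x} x∈q → from (p⇔ x) (to (q⇔ x) x∈q))

⊂⇒⊉ : ∀ {m} {p q : Subset m} → p ⊂ q → ¬ q ⊆ p
⊂⇒⊉ (_ , _ , x∈q , x∉p) q⊆p = x∉p (q⊆p x∈q)

⊆⇒≡⊎⊂ : ∀ {m} {p q : Subset m} → p ⊆ q → p ≡ q ⊎ p ⊂ q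
⊆⇒≡⊎⊂ {p = p} {q} p⊆q with Finₚ.any? (λ x → (x Subsetₚ.∈? q) ×-dec ¬? (x Subsetₚ.∈? p))
... | yes (x , x∈q , x∉p) = inj₂ (p⊆q , x , x∈q , x∉p)
... | no none = inj₁ (Subsetₚ.⊆-antisym p⊆q λ {x} x∈q →
  decidable-stable (x Subsetₚ.∈? p) (λ x∉p → none (x , x∈q , x∉p)))

module Dominators (G : Graph) (reach : AllReachable G) where
  open Graph G

  private
    variable
      u v w x y z a b c c′ : Fin n
      M P : Subset n

  infixr 5 _++ʷ_
  infix 4 _∈ʷ_ _∉ʷ_ _≥ₛ_ _>ₛ_ _⋗_

  _∈ʷ_ _∉ʷ_ : Fin n → Walk G u v → Set
  x ∈ʷ p = OnWalk G x p
  x ∉ʷ p = ¬ x ∈ʷ p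

  Allʷ : Pred (Fin n) 0ℓ → Walk G u v → Set
  Allʷ P p = ∀ {x} → x ∈ʷ p → P x

  _++ʷ_ : Walk G u v → Walk G v w → Walk G u w
  []      ++ʷ q = q
  (e ∷ p) ++ʷ q = e ∷ (p ++ʷ q)

  start∈ʷ : (p : Walk G u v) → u ∈ʷ p
  start∈ʷ []      = refl
  start∈ʷ (_ ∷ _) = inj₁ refl

  end∈ʷ : (p : Walk G u v) → v ∈ʷ p
  end∈ʷ []      = refl
  end∈ʷ (_ ∷ p) = inj₂ (end∈ʷ p)

  ∈ʷ-++⁻ : (p : Walk G u v) {q : Walk G v w} → x ∈ʷ p ++ʷ q → x ∈ʷ p ⊎ x ∈ʷ q
  ∈ʷ-++⁻ []      x∈q         = inj₂ x∈q
  ∈ʷ-++⁻ (_ ∷ _) (inj₁ x≡u)  = inj₁ (inj₁ x≡u)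
  ∈ʷ-++⁻ (_ ∷ p) (inj₂ x∈pq) = Sum.map₁ inj₂ (∈ʷ-++⁻ p x∈pq)

  _∈ʷ?_ : ∀ x (p : Walk G u v) → Dec (x ∈ʷ p)
  x ∈ʷ? []      = x ≟ _
  x ∈ʷ? (_ ∷ p) = (x ≟ _) ⊎-dec (x ∈ʷ? p)

  prefix : (p : Walk G u v) → x ∈ʷ p → Σ (Walk G u x) (Allʷ (_∈ʷ p))
  prefix []      refl        = [] , id
  prefix (_ ∷ _) (inj₁ refl) = [] , inj₁
  prefix (e ∷ p) (inj₂ x∈p) with q , q⊆p ← prefix p x∈p = e ∷ q , Sum.map₂ q⊆p

  suffix : (p : Walk G u v) → x ∈ʷ p → Σ (Walk G x v) (Allʷ (_∈ʷ p))
  suffix []      refl        = [] , id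
  suffix (e ∷ p) (inj₁ refl) = e ∷ p , id
  suffix (_ ∷ p) (inj₂ x∈p) with r , r⊆p ← suffix p x∈p = r , λ y∈r → inj₂ (r⊆p y∈r)

  suffix-avoiding : (p : Walk G w v) → u ∉ʷ p → z ∈ʷ p → Σ (Walk G z v) (u ∉ʷ_)
  suffix-avoiding p u∉p z∈p with r , r⊆p ← suffix p z∈p = r , λ u∈r → u∉p (r⊆p u∈r)

  lastVisit : (p : Walk G w v) → u ∈ʷ p →
              Σ (Walk G u v) (Allʷ (λ z → z ≡ u ⊎ Σ (Walk G z v) (u ∉ʷ_)))
  lastVisit [] refl = [] , inj₁
  lastVisit {u = u} (e ∷ p) u∈ep with u ∈ʷ? p | u∈ep
  ... | yes u∈p | _         = lastVisit p u∈p
  ... | no u∉p  | inj₂ u∈p  = ⊥-elim (u∉p u∈p)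
  ... | no u∉p  | inj₁ refl = e ∷ p , [ inj₁ , (λ z∈p → inj₂ (suffix-avoiding p u∉p z∈p)) ]

  firstOf : (p : Walk G u v) → x ∈ʷ p → y ∈ʷ p → x ≢ y →
            Σ (Walk G u x) (y ∉ʷ_) ⊎ Σ (Walk G u y) (x ∉ʷ_)
  firstOf {u = u} {x = x} {y = y} p x∈p y∈p x≢y with x ≟ u | y ≟ u
  ... | yes refl | _        = inj₁ ([] , x≢y ∘ sym)
  ... | no _     | yes refl = inj₂ ([] , x≢y)
  firstOf []      refl       _          _   | no x≢u | _      = ⊥-elim (x≢u refl)
  firstOf (_ ∷ _) (inj₁ x≡u) _          _   | no x≢u | _      = ⊥-elim (x≢u x≡u)
  firstOf (_ ∷ _) (inj₂ _)   (inj₁ y≡u) _   | _      | no y≢u = ⊥-elim (y≢u y≡u)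
  firstOf (e ∷ p) (inj₂ x∈p) (inj₂ y∈p) x≢y | no x≢u | no y≢u =
    Sum.map (λ (q , y∉q) → e ∷ q , [ y≢u , y∉q ]) (λ (q , x∉q) → e ∷ q , [ x≢u , x∉q ])
            (firstOf p x∈p y∈p x≢y)

  _≥ₛ_ _>ₛ_ _⋗_ : Fin n → Fin n → Set
  _≥ₛ_ = Dom G
  _>ₛ_ = StrictDom G
  _⋗_  = Child G

  Avoiding : Fin n → Fin n → Set
  Avoiding a b = Σ (Walk G s b) (a ∉ʷ_)

  ¬avoiding⇒≥ₛ : ¬ Avoiding a b → a ≥ₛ b
  ¬avoiding⇒≥ₛ {a = a} never p = decidable-stable (a ∈ʷ? p) (λ a∉p → never (p , a∉p))

  ≥ₛ-stable : ¬ ¬ a ≥ₛ b → a ≥ₛ b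
  ≥ₛ-stable ¬¬a≥b = ¬avoiding⇒≥ₛ λ (p , a∉p) → ¬¬a≥b λ a≥b → a∉p (a≥b p)

  ≥ₛ-refl : a ≥ₛ a
  ≥ₛ-refl = end∈ʷ

  s≥ₛ : s ≥ₛ a
  s≥ₛ = start∈ʷ

  ≥ₛs⇒≡s : a ≥ₛ s → a ≡ s
  ≥ₛs⇒≡s a≥s = a≥s []

  ≥ₛ-trans : a ≥ₛ b → b ≥ₛ c → a ≥ₛ c
  ≥ₛ-trans a≥b b≥c p with q , q⊆p ← prefix p (b≥c p) = q⊆p (a≥b q)

  -- On a walk from s to a through b, whichever of a and b comes first is reached avoiding the other.
  ≥ₛ-antisym : a ≥ₛ b → b ≥ₛ a → a ≡ b
  ≥ₛ-antisym {a} {b} a≥b b≥a = decidable-stable (a ≟ b) λ a≢b →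
    [ (λ (q , b∉q) → b∉q (b≥a q)) , (λ (q , a∉q) → a∉q (a≥b q)) ]
      (firstOf (reach a) (end∈ʷ (reach a)) (b≥a (reach a)) a≢b)

  walkInside : a ≥ₛ x → Σ (Walk G a x) (Allʷ (a ≥ₛ_))
  walkInside {a} {x} a≥x with r , lastA ← lastVisit (reach x) (a≥x (reach x)) =
    r , λ z∈r → [ (λ { refl → ≥ₛ-refl }) , onward ] (lastA z∈r)
    where
    onward : Σ (Walk G z x) (a ∉ʷ_) → a ≥ₛ z
    onward (q , a∉q) = ¬avoiding⇒≥ₛ λ (q′ , a∉q′) → [ a∉q′ , a∉q ] (∈ʷ-++⁻ q′ (a≥x (q′ ++ʷ q)))

  ≥ₛ-comparable : a ≥ₛ x → b ≥ₛ x → ¬ a ≥ₛ b → b ≥ₛ a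
  ≥ₛ-comparable a≥x b≥x a≱b with r , r⊆Da ← walkInside a≥x =
    ¬avoiding⇒≥ₛ λ (q , b∉q) → [ b∉q , (λ b∈r → a≱b (r⊆Da b∈r)) ] (∈ʷ-++⁻ q (b≥x (q ++ʷ r)))

  arc-into-≥ₛ : E x y → v ≥ₛ y → y ≢ v → v ≥ₛ x
  arc-into-≥ₛ e v≥y y≢v = ¬avoiding⇒≥ₛ λ (q , v∉q) →
    [ v∉q , [ (λ { refl → v∉q (end∈ʷ q) }) , (λ { refl → y≢v refl }) ] ] (∈ʷ-++⁻ q (v≥y (q ++ʷ e ∷ [])))

  >ₛ-≥ₛ-trans : a >ₛ b → b ≥ₛ c → a >ₛ c
  >ₛ-≥ₛ-trans (a≥b , a≢b) b≥c = ≥ₛ-trans a≥b b≥c , λ { refl → a≢b (≥ₛ-antisym a≥b b≥c) }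

  >ₛ-isStrictPartialOrder : IsStrictPartialOrder _≡_ _>ₛ_
  >ₛ-isStrictPartialOrder = record
    { isEquivalence = isEquivalence
    ; irrefl        = λ { refl (_ , a≢a) → a≢a refl }
    ; trans         = λ a>b b>c → >ₛ-≥ₛ-trans a>b (proj₁ b>c)
    ; <-resp-≈      = (λ { refl → id }) , (λ { refl → id })
    }

  >ₛ-wellFounded : WellFounded _>ₛ_
  >ₛ-wellFounded = spo-wellFounded >ₛ-isStrictPartialOrder

  <ₛ-wellFounded : WellFounded (flip _>ₛ_)
  <ₛ-wellFounded = spo-noetherian >ₛ-isStrictPartialOrder

  ⋗-≥ₛ : a ⋗ b → b ≥ₛ x → a >ₛ x
  ⋗-≥ₛ (a>b , _) = >ₛ-≥ₛ-trans a>b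

  ⋗-unique : a ⋗ c → a ⋗ c′ → c ≥ₛ x → c′ ≥ₛ x → c ≡ c′
  ⋗-unique a⋗c a⋗c′ c≥x c′≥x = decidable-stable (_ ≟ _) λ c≢c′ →
    proj₂ a⋗c _ (proj₁ a⋗c′)
      (≥ₛ-comparable c≥x c′≥x (λ c≥c′ → proj₂ a⋗c′ _ (proj₁ a⋗c) (c≥c′ , c≢c′)) , c≢c′ ∘ sym)

  ≥ₛ-parent : c ⋗ b → a ≥ₛ b → a ≢ b → a ≥ₛ c
  ≥ₛ-parent {a = a} c⋗b a≥b a≢b = ≥ₛ-stable λ a≱c →
    proj₂ c⋗b a (≥ₛ-comparable a≥b (proj₁ (proj₁ c⋗b)) a≱c , λ { refl → a≱c ≥ₛ-refl }) (a≥b , a≢b)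

  entry : IsModule G M → Fin n
  entry = proj₁

  entry∈ : (md : IsModule G M) → entry md ∈ M
  entry∈ = proj₁ ∘ proj₂

  entry-on-walk : (md : IsModule G M) (p : Walk G u x) → u ∉ M → x ∈ M → entry md ∈ʷ p
  entry-on-walk md [] u∉M u∈M = ⊥-elim (u∉M u∈M)
  entry-on-walk {M} md (_∷_ {v = v} e p) u∉M x∈M with v Subsetₚ.∈? M
  ... | yes v∈M = inj₂ (subst (_∈ʷ p) (proj₂ (proj₂ (proj₂ md)) _ _ e u∉M v∈M) (start∈ʷ p))
  ... | no v∉M  = inj₂ (entry-on-walk md p v∉M x∈M)

  entry-≥ₛ : (md : IsModule G M) → x ∈ M → entry md ≥ₛ x
  entry-≥ₛ {M} md x∈M p with s Subsetₚ.∈? M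
  ... | yes s∈M = subst (_∈ʷ p) (sym (proj₁ (proj₂ (proj₂ md)) s∈M)) (start∈ʷ p)
  ... | no s∉M  = entry-on-walk md p s∉M x∈M

  entry-child : (md : IsModule G P) → a ∉ P → a ⋗ w → w ∈ P → entry md ≡ w
  entry-child md a∉P a⋗w w∈P with r , r⊆Da ← walkInside (proj₁ (proj₁ a⋗w)) =
    decidable-stable (entry md ≟ _) λ m≢w →
      proj₂ a⋗w (entry md) (r⊆Da (entry-on-walk md r a∉P w∈P) , λ { refl → a∉P (entry∈ md) })
                           (entry-≥ₛ md w∈P , m≢w)

  module Decidable⋗ (_⋗?_ : ∀ a b → Dec (a ⋗ b)) where

    parent : b ≢ s → ∃ λ c → c ⋗ b
    parent {b} b≢s = decidable-stable (Finₚ.any? (_⋗? b)) λ orphan →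
      wf-minimal <ₛ-wellFounded {P = _>ₛ b} (s≥ₛ , b≢s ∘ sym) λ (c , c>b , lowest) →
        orphan (c , c>b , λ d c>d d>b → lowest d>b c>d)

    _≥ₛ?_ : ∀ a b → Dec (a ≥ₛ b)
    a ≥ₛ? b = go (>ₛ-wellFounded b)
      where
      go : ∀ {b} → Acc _>ₛ_ b → Dec (a ≥ₛ b)
      go {b} (acc above) with a ≟ b | b ≟ s
      ... | yes refl | _        = yes ≥ₛ-refl
      ... | no a≢b   | yes refl = no (a≢b ∘ ≥ₛs⇒≡s)
      ... | no a≢b   | no b≢s with c , c⋗b ← parent b≢s =
        map′ (λ a≥c → ≥ₛ-trans a≥c (proj₁ (proj₁ c⋗b))) (λ a≥b → ≥ₛ-parent c⋗b a≥b a≢b)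
             (go (above (proj₁ c⋗b)))

    child-above : a >ₛ x → ∃ λ c → a ⋗ c × c ≥ₛ x
    child-above {a} {x} a>x = decidable-stable (Finₚ.any? λ c → (a ⋗? c) ×-dec (c ≥ₛ? x)) λ none →
      wf-minimal >ₛ-wellFounded {P = λ c → a >ₛ c × c ≥ₛ x} (a>x , ≥ₛ-refl)
        λ (c , (a>c , c≥x) , highest) →
          none (c , (a>c , λ d a>d d>c → highest (a>d , ≥ₛ-trans (proj₁ d>c) c≥x) d>c) , c≥x)

module MaximalParts (G : Graph) {F : Family G} (nd : IsNestingDecomposition G F) where
  open Graph G
  open IsNestingDecomposition nd

  private
    variable
      x y a : Fin n
      M H L : Subset n

  inhabited : F M → ∃ (_∈ M)
  inhabited {M} FM with m , m∈M , _ ← modules M FM = m , m∈M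

  singleton-maxParts : HasSize G (MaxPart G F ⁅ a ⁆) 0
  singleton-maxParts {a} = [] , [] , refl , λ H → mk⇔ (λ ()) (⊥-elim ∘ noPart H)
    where
    noPart : ∀ H → ¬ MaxPart G F ⁅ a ⁆ H
    noPart H (FH , (H⊆a , y , y∈a , y∉H) , _) with x , x∈H ← inhabited FH =
      y∉H (subst (_∈ H) (trans (Subsetₚ.x∈⁅y⁆⇒x≡y a (H⊆a x∈H)) (sym (Subsetₚ.x∈⁅y⁆⇒x≡y a y∈a))) x∈H)

  maxParts-intersecting : MaxPart G F M H → MaxPart G F M L → x ∈ H → x ∈ L → H ≡ L
  maxParts-intersecting (FH , H⊂M , H-max) (FL , L⊂M , L-max) x∈H x∈L with nonOverlap _ _ FH FL
  ... | inj₁ disjoint   = ⊥-elim (disjoint _ x∈H x∈L)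
  ... | inj₂ (inj₁ H⊆L) = [ id  , (λ H⊂L → ⊥-elim (H-max _ FL H⊂L L⊂M)) ] (⊆⇒≡⊎⊂ H⊆L)
  ... | inj₂ (inj₂ L⊆H) = [ sym , (λ L⊂H → ⊥-elim (L-max _ FH L⊂H H⊂M)) ] (⊆⇒≡⊎⊂ L⊆H)

  maxParts-enumerated : ∀ {Ls} → Unique Ls → (∀ {L} → L ∈ˡ Ls → MaxPart G F M L) →
                        (∀ {x} → x ∈ M → ∃ λ L → L ∈ˡ Ls × x ∈ L) →
                        HasSize G (MaxPart G F M) (length Ls)
  maxParts-enumerated {M} {Ls} unique maximal cover = Ls , unique , refl , λ H → mk⇔ maximal (listed H)
    where
    listed : ∀ H → MaxPart G F M H → H ∈ˡ Ls
    listed H H-max with x , x∈H ← inhabited (proj₁ H-max)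
                   with L , L∈Ls , x∈L ← cover (proj₁ (proj₁ (proj₂ H-max)) x∈H) =
      subst (_∈ˡ Ls) (sym (maxParts-intersecting H-max (maximal L∈Ls) x∈H x∈L)) L∈Ls

  maxPart-containing : ∀ {xs} → (∀ H → H ∈ˡ xs ⇔ MaxPart G F M H) → x ∈ M → y ∈ M → x ≢ y →
                       ∃ λ H → MaxPart G F M H × x ∈ H
  maxPart-containing {M} {x} {y} {xs} enum x∈M y∈M x≢y =
    found (decidable-stable (any? (x Subsetₚ.∈?_) xs) (¬¬-map listed exists))
    where
    ⁅x⁆⊂M : ⁅ x ⁆ ⊂ M
    ⁅x⁆⊂M = (λ z∈ → subst (_∈ M) (sym (Subsetₚ.x∈⁅y⁆⇒x≡y x z∈)) x∈M) ,
            y , y∈M , Subsetₚ.x≢y⇒x∉⁅y⁆ (x≢y ∘ sym)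

    exists : ¬ ¬ ∃ λ H → MaxPart G F M H × x ∈ H
    exists = ¬¬-map (λ (H , (FH , x∈H , H⊂M) , top) →
                       H , (FH , H⊂M , λ K FK H⊂K K⊂M → top (FK , proj₁ H⊂K x∈H , K⊂M) H⊂K) , x∈H)
                    (wf-minimal ⊃-wellFounded {P = λ K → F K × x ∈ K × K ⊂ M}
                                (hasTrivial ⁅ x ⁆ (inj₂ (x , refl)) , Subsetₚ.x∈⁅x⁆ x , ⁅x⁆⊂M))

    listed : (∃ λ H → MaxPart G F M H × x ∈ H) → Any (x ∈_) xs
    listed (H , H-max , x∈H) = lose (from (enum H) H-max) x∈H

    found : Any (x ∈_) xs → ∃ λ H → MaxPart G F M H × x ∈ H
    found x∈some with H , H∈xs , x∈H ← find x∈some = H , to (enum H) H∈xs , x∈H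

module ACTree (G : Graph) (reach : AllReachable G) (k : Fin (Graph.n G) → ℕ)
              (S : (a : Fin (Graph.n G)) → Fin (k a) → Subset (Graph.n G)) (T : IsACTree G k S) where
  open Graph G
  open IsACTree T
  open Dominators G reach

  private
    variable
      a b v w x y : Fin n
      t t′ t″ : ℕ
      M N : Subset n

  scc-⊆ : IsSCC G a M → IsSCC G a N → v ∈ M → v ∈ N → M ⊆ N
  scc-⊆ (_ , _ , ∈M) (_ , _ , ∈N) v∈M v∈N {x} x∈M
    with _ , r→v , v→r ← to (∈M _) v∈M | _ , r′→v , v→r′ ← to (∈N _) v∈N
       | a⋗x , r→x , x→r ← to (∈M x) x∈M =
    from (∈N x) (a⋗x , r′→v ◅◅ v→r ◅◅ r→x , x→r ◅◅ r→v ◅◅ v→r′)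

  scc⇒⋗ : ∀ {i} → v ∈ S a i → a ⋗ v
  scc⇒⋗ {a = a} {i = i} v∈ with _ , _ , member ← scc a i = proj₁ (to (member _) v∈)

  scc-inhabited : ∀ a i → ∃ (_∈ S a i)
  scc-inhabited a i with r , a⋗r , member ← scc a i = r , from (member r) (a⋗r , ε , ε)

  scc-connected : ∀ {i} → v ∈ S a i → w ∈ S a i → Star (ArcA G a) w v
  scc-connected {a = a} {i = i} v∈ w∈ with _ , _ , member ← scc a i =
    proj₂ (proj₂ (to (member _) w∈)) ◅◅ proj₁ (proj₂ (to (member _) v∈))

  scc-index-unique : ∀ {i j} → v ∈ S a i → v ∈ S a j → i ≡ j
  scc-index-unique {a = a} {i = i} {j = j} v∈i v∈j =
    inj a i j (Subsetₚ.⊆-antisym (scc-⊆ (scc a i) (scc a j) v∈i v∈j) (scc-⊆ (scc a j) (scc a i) v∈j v∈i))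

  -- E is not decidable, so the child relation (hence dominance) is decided through the A-C tree.
  _⋗?_ : ∀ a v → Dec (a ⋗ v)
  a ⋗? v = map′ (λ (_ , v∈) → scc⇒⋗ v∈) (cover a v) (Finₚ.any? λ i → v Subsetₚ.∈? S a i)

  open Decidable⋗ _⋗?_

  arc-between-children : a ⋗ v → a ⋗ w → v ≢ w → v ≥ₛ x → w ≥ₛ y → E x y → y ≡ w
  arc-between-children a⋗v a⋗w v≢w v≥x w≥y e = decidable-stable (_ ≟ _) λ y≢w →
    v≢w (⋗-unique a⋗v a⋗w v≥x (arc-into-≥ₛ e w≥y y≢w))

  sccWalk : a ⋗ v → Star (ArcA G a) v w → Σ (Walk G v w) (Allʷ (a >ₛ_))
  sccWalk a⋗v ε = [] , λ { refl → proj₁ a⋗v }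
  sccWalk a⋗v ((_ , a⋗v′ , v≢v′ , x , y , v≥x , v′≥y , _ , _ , e) ◅ rest)
    with refl ← arc-between-children a⋗v a⋗v′ v≢v′ v≥x v′≥y e
    with r , r⊆Dv ← walkInside v≥x | q , q<a ← sccWalk a⋗v′ rest =
    r ++ʷ e ∷ q ,
    λ z∈ → [ (λ z∈r → ⋗-≥ₛ a⋗v (r⊆Dv z∈r)) , [ (λ { refl → ⋗-≥ₛ a⋗v v≥x }) , q<a ] ] (∈ʷ-++⁻ r z∈)

  sccWalkTo : ∀ {i} → v ∈ S a i → w ∈ S a i → v ≥ₛ x → Σ (Walk G w x) (Allʷ (a >ₛ_))
  sccWalkTo v∈ w∈ v≥x
    with q , q<a ← sccWalk (scc⇒⋗ w∈) (scc-connected v∈ w∈) | r , r⊆Dv ← walkInside v≥x =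
    q ++ʷ r , λ z∈ → [ q<a , (λ z∈r → ⋗-≥ₛ (scc⇒⋗ v∈) (r⊆Dv z∈r)) ] (∈ʷ-++⁻ q z∈)

  module⊇scc : ∀ {j} → IsModule G M → a ∈ M → x ∈ M → v ∈ S a j → v ≥ₛ x → S a j ⊆ M
  module⊇scc {M} md a∈M x∈M v∈ v≥x {w} w∈ = decidable-stable (w Subsetₚ.∈? M) λ w∉M →
    let p , p<a   = sccWalkTo v∈ w∈ v≥x
        a≥m , a≢m = p<a (entry-on-walk md p w∉M x∈M)
    in a≢m (≥ₛ-antisym a≥m (entry-≥ₛ md a∈M))

  InAC : Fin n → ℕ → Pred (Fin n) 0ℓ
  InAC a t x = x ≡ a ⊎ ∃ λ i → toℕ i < t × InDS G (S a i) x

  inAC? : ∀ a t → Decidable (InAC a t)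
  inAC? a t x = (x ≟ a) ⊎-dec Finₚ.any? λ i →
    (toℕ i ℕₚ.<? t) ×-dec Finₚ.any? λ v → (v Subsetₚ.∈? S a i) ×-dec (v ≥ₛ? x)

  -- acSet a t = {a} ∪ D(S a 0) ∪ … ∪ D(S a (t - 1)): acSet a 0 = {a}, acSet a (k a) = D(a),
  -- and the paper's set for (a, j) is acSet a (j + 1).
  acSet : Fin n → ℕ → Subset n
  acSet a t = ⟦ inAC? a t ⟧

  D : Fin n → Subset n
  D v = acSet v (k v)

  acSet-elim : x ∈ acSet a t → InAC a t x
  acSet-elim {a = a} {t} = ∈⟦⟧⁻ (inAC? a t)

  a∈acSet : a ∈ acSet a t
  a∈acSet {a} {t} = ∈⟦⟧⁺ (inAC? a t) (inj₁ refl)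

  acSet-intro : ∀ {i} → v ∈ S a i → toℕ i < t → v ≥ₛ x → x ∈ acSet a t
  acSet-intro {a = a} {t = t} v∈ i<t v≥x = ∈⟦⟧⁺ (inAC? a t) (inj₂ (_ , i<t , _ , v∈ , v≥x))

  acSet⊆D : x ∈ acSet a t → a ≥ₛ x
  acSet⊆D x∈ with acSet-elim x∈
  ... | inj₁ refl                   = ≥ₛ-refl
  ... | inj₂ (_ , _ , _ , v∈ , v≥x) = proj₁ (⋗-≥ₛ (scc⇒⋗ v∈) v≥x)

  D⊆acSet : a ≥ₛ x → x ∈ acSet a (k a)
  D⊆acSet {a} {x} a≥x with x ≟ a
  ... | yes refl = a∈acSet
  ... | no x≢a with c , a⋗c , c≥x ← child-above (a≥x , x≢a ∘ sym)
               with i , c∈ ← cover a c a⋗c = acSet-intro c∈ (Finₚ.toℕ<n i) c≥x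

  acSet-mono : t ≤ t′ → acSet a t ⊆ acSet a t′
  acSet-mono t≤t′ x∈ with acSet-elim x∈
  ... | inj₁ refl                     = a∈acSet
  ... | inj₂ (_ , i<t , _ , v∈ , v≥x) = acSet-intro v∈ (ℕₚ.<-≤-trans i<t t≤t′) v≥x

  ∈acSet⇒index< : ∀ {i} → v ∈ S a i → v ≥ₛ x → x ∈ acSet a t → toℕ i < t
  ∈acSet⇒index< v∈ v≥x x∈ with acSet-elim x∈
  ... | inj₁ refl = ⊥-elim (proj₂ (⋗-≥ₛ (scc⇒⋗ v∈) v≥x) refl)
  ... | inj₂ (_ , i′<t , _ , v′∈ , v′≥x)
      with refl ← ⋗-unique (scc⇒⋗ v∈) (scc⇒⋗ v′∈) v≥x v′≥x
      with refl ← scc-index-unique v∈ v′∈ = i′<t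

  acSet-zero : acSet a 0 ≡ ⁅ a ⁆
  acSet-zero {a} = Subsetₚ.⊆-antisym only
    (λ x∈ → subst (_∈ acSet a 0) (sym (Subsetₚ.x∈⁅y⁆⇒x≡y a x∈)) a∈acSet)
    where
    only : acSet a 0 ⊆ ⁅ a ⁆
    only x∈ with acSet-elim x∈
    ... | inj₁ refl         = Subsetₚ.x∈⁅x⁆ a
    ... | inj₂ (_ , () , _)

  acSet-s : acSet s (k s) ≡ ⊤
  acSet-s = Subsetₚ.⊆-antisym (λ _ → Subsetₚ.∈⊤) (λ _ → D⊆acSet s≥ₛ)

  ACSet-acSet : ∀ a j → ACSet G k S (acSet a (suc (toℕ j)))
  ACSet-acSet a j = a , j , λ x →
    mk⇔ (Sum.map₂ (λ (i , i<j+1 , x∈D) → i , ℕₚ.≤-pred i<j+1 , x∈D) ∘ acSet-elim)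
        (∈⟦⟧⁺ (inAC? a _) ∘ Sum.map₂ (λ (i , i≤j , x∈D) → i , s≤s i≤j , x∈D))

  AC⇒acSet : AC G k S M → ∃ λ a → ∃ λ (t : Fin (suc (k a))) → M ≡ acSet a (toℕ t)
  AC⇒acSet (inj₁ (a , j , M⇔)) = a , suc j , same-members M⇔ (proj₂ (proj₂ (ACSet-acSet a j)))
  AC⇒acSet (inj₂ (inj₁ refl)) =
    s , fromℕ (k s) , trans (sym acSet-s) (cong (acSet s) (sym (Finₚ.toℕ-fromℕ (k s))))
  AC⇒acSet (inj₂ (inj₂ (a , refl))) = a , zero , sym acSet-zero

  acSet∈AC : t ≤ k a → AC G k S (acSet a t)
  acSet∈AC {zero}  _     = inj₂ (inj₂ (_ , acSet-zero))
  acSet∈AC {suc t} {a} t<ka = inj₁ (subst (ACSet G k S) (cong (acSet a ∘ suc) (Finₚ.toℕ-fromℕ< t<ka))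
                                          (ACSet-acSet a (fromℕ< t<ka)))

  -- This is where the topological order of the components is used.
  arc-into-scc : ∀ {i} → E x y → a >ₛ x → v ∈ S a i → v ≥ₛ y → ¬ v ≥ₛ x →
                 ∃ λ i′ → toℕ i′ ≤ toℕ i × InDS G (S a i′) x
  arc-into-scc {x} {y} {a} {i = i} e a>x v∈ v≥y v≱x
    with u , a⋗u , u≥x ← child-above a>x
    with i′ , u∈ ← cover a u a⋗u =
    i′ , topo a i′ i u _ u∈ v∈ (a⋗u , a⋗v , (λ { refl → v≱x u≥x }) , x , y , u≥x , v≥y ,
                                proj₁ a>x , proj₁ (⋗-≥ₛ a⋗v v≥y) , e) ,
    u , u∈ , u≥x
    where
    a⋗v = scc⇒⋗ v∈

  acSet-pred : E x y → y ∈ acSet a t → y ≢ a → x ∈ acSet a t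
  acSet-pred {x} {a = a} e y∈ y≢a with acSet-elim y∈
  ... | inj₁ y≡a = ⊥-elim (y≢a y≡a)
  ... | inj₂ (_ , i<t , v , v∈ , v≥y) with v ≥ₛ? x | x ≟ a
  ...   | yes v≥x | _        = acSet-intro v∈ i<t v≥x
  ...   | no _    | yes refl = a∈acSet
  ...   | no v≱x  | no x≢a
        with a>x ← (arc-into-≥ₛ e (acSet⊆D y∈) y≢a , x≢a ∘ sym)
        with _ , i′≤i , _ , u∈ , u≥x ← arc-into-scc e a>x v∈ v≥y v≱x =
    acSet-intro u∈ (ℕₚ.≤-<-trans i′≤i i<t) u≥x

  acSet-isModule : IsModule G (acSet a t)
  acSet-isModule {a} = a , a∈acSet , (λ s∈ → ≥ₛs⇒≡s (acSet⊆D s∈)) , λ x y e x∉ y∈ →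
    decidable-stable (y ≟ a) λ y≢a → x∉ (acSet-pred e y∈ y≢a)

  nonOverlapping-sym : NonOverlapping G M N → NonOverlapping G N M
  nonOverlapping-sym = [ (λ disjoint → inj₁ λ x x∈N x∈M → disjoint x x∈M x∈N) , inj₂ ∘ Sum.swap ]

  acSet-nested : a ≥ₛ b → NonOverlapping G (acSet a t) (acSet b t′)
  acSet-nested {a} {b} {t} {t′} a≥b with a ≟ b
  ... | yes refl = [ inj₂ ∘ inj₁ ∘ acSet-mono , inj₂ ∘ inj₂ ∘ acSet-mono ]′ (ℕₚ.≤-total t t′)
  ... | no a≢b with c , a⋗c , c≥b ← child-above (a≥b , a≢b)
               with i , c∈ ← cover a c a⋗c
               with toℕ i ℕₚ.<? t
  ...   | yes i<t = inj₂ (inj₂ λ x∈ → acSet-intro c∈ i<t (≥ₛ-trans c≥b (acSet⊆D x∈)))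
  ...   | no i≮t  = inj₁ λ x x∈a x∈b → i≮t (∈acSet⇒index< c∈ (≥ₛ-trans c≥b (acSet⊆D x∈b)) x∈a)

  acSet-nonOverlapping : ∀ a t b t′ → NonOverlapping G (acSet a t) (acSet b t′)
  acSet-nonOverlapping a t b t′ with a ≥ₛ? b | b ≥ₛ? a
  ... | yes a≥b | _       = acSet-nested a≥b
  ... | no _    | yes b≥a = nonOverlapping-sym (acSet-nested b≥a)
  ... | no a≱b  | no b≱a  = inj₁ λ x x∈a x∈b → b≱a (≥ₛ-comparable (acSet⊆D x∈a) (acSet⊆D x∈b) a≱b)

  AC-isNestingDecomposition : IsNestingDecomposition G (AC G k S)
  AC-isNestingDecomposition = record
    { modules    = λ _ → isModule
    ; nonOverlap = λ _ _ → nonOverlapping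
    ; hasTrivial = λ _ → inj₂
    }
    where
    isModule : AC G k S M → IsModule G M
    isModule M∈AC with _ , _ , refl ← AC⇒acSet M∈AC = acSet-isModule

    nonOverlapping : AC G k S M → AC G k S N → NonOverlapping G M N
    nonOverlapping M∈AC N∈AC with a , _ , refl ← AC⇒acSet M∈AC | b , _ , refl ← AC⇒acSet N∈AC =
      acSet-nonOverlapping a _ b _

  open MaximalParts G AC-isNestingDecomposition using (singleton-maxParts; maxParts-enumerated)

  sandwiched-root : acSet a t ⊆ acSet b t′ → acSet b t′ ⊆ acSet a t″ → b ≡ a
  sandwiched-root lower⊆ ⊆upper = ≥ₛ-antisym (acSet⊆D (lower⊆ a∈acSet)) (acSet⊆D (⊆upper a∈acSet))

  no-AC-between-levels : AC G k S M → acSet a t ⊂ M → M ⊂ acSet a (suc t) → ⊥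
  no-AC-between-levels {t = t} M∈AC lower⊂M M⊂upper
    with _ , u , refl ← AC⇒acSet M∈AC
    with refl ← sandwiched-root (proj₁ lower⊂M) (proj₁ M⊂upper)
    with toℕ u ℕₚ.≤? t
  ... | yes u≤t = ⊂⇒⊉ lower⊂M (acSet-mono u≤t)
  ... | no u≰t  = ⊂⇒⊉ M⊂upper (acSet-mono (ℕₚ.≰⇒> u≰t))

  ⋗⇒∉D : a ⋗ v → a ∉ D v
  ⋗⇒∉D a⋗v a∈Dv = proj₂ (⋗-≥ₛ a⋗v (acSet⊆D a∈Dv)) refl

  D-injective : D v ≡ D w → v ≡ w
  D-injective Dv≡Dw = ≥ₛ-antisym (acSet⊆D (subst (_ ∈_) (sym Dv≡Dw) a∈acSet))
                                 (acSet⊆D (subst (_ ∈_) Dv≡Dw a∈acSet))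

  module _ (a : Fin n) (j : Fin (k a)) where

    private
      upper = acSet a (suc (toℕ j))

    maxPart-lower : MaxPart G (AC G k S) upper (acSet a (toℕ j))
    maxPart-lower with r , r∈ ← scc-inhabited a j =
      acSet∈AC (ℕₚ.<⇒≤ (Finₚ.toℕ<n j)) ,
      (acSet-mono (ℕₚ.n≤1+n _) , r , acSet-intro r∈ ℕₚ.≤-refl ≥ₛ-refl ,
       λ r∈lower → ℕₚ.<-irrefl refl (∈acSet⇒index< r∈ ≥ₛ-refl r∈lower)) ,
      λ _ → no-AC-between-levels

    maxPart-D : v ∈ S a j → MaxPart G (AC G k S) upper (D v)
    maxPart-D {v} v∈ = acSet∈AC ℕₚ.≤-refl , (Dv⊆upper , a , a∈acSet , ⋗⇒∉D a⋗v) , between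
      where
      a⋗v = scc⇒⋗ v∈

      Dv⊆upper : D v ⊆ upper
      Dv⊆upper x∈ = acSet-intro v∈ ℕₚ.≤-refl (acSet⊆D x∈)

      between : ∀ M → AC G k S M → D v ⊂ M → M ⊂ upper → ⊥
      between M M∈AC Dv⊂M M⊂upper with b , _ , refl ← AC⇒acSet M∈AC with a ≟ b
      ... | yes refl = ⊂⇒⊉ M⊂upper (acSet-mono (∈acSet⇒index< v∈ ≥ₛ-refl (proj₁ Dv⊂M a∈acSet)))
      ... | no a≢b
          with c , a⋗c , c≥b ← child-above (acSet⊆D (proj₁ M⊂upper a∈acSet) , a≢b)
          with b≥v ← acSet⊆D (proj₁ Dv⊂M a∈acSet)
          with refl ← ⋗-unique a⋗c a⋗v (≥ₛ-trans c≥b b≥v) ≥ₛ-refl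
          with refl ← ≥ₛ-antisym b≥v c≥b =
        ⊂⇒⊉ Dv⊂M (λ x∈ → D⊆acSet (acSet⊆D x∈))

    maxParts : List (Subset n)
    maxParts = acSet a (toℕ j) ∷ List.map D (elements (S a j))

    maxParts-unique : Unique maxParts
    maxParts-unique = All.tabulate lower∉ ∷ Uniqueₚ.map⁺ D-injective (elements-unique (S a j))
      where
      lower∉ : ∀ {L} → L ∈ˡ List.map D (elements (S a j)) → acSet a (toℕ j) ≢ L
      lower∉ L∈ lower≡L with v , v∈ , refl ← ∈ₚ.∈-map⁻ D L∈ =
        ⋗⇒∉D (scc⇒⋗ (∈-elements⁻ v∈)) (subst (a ∈_) lower≡L a∈acSet)

    maxParts-maximal : ∀ {L} → L ∈ˡ maxParts → MaxPart G (AC G k S) upper L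
    maxParts-maximal (here refl) = maxPart-lower
    maxParts-maximal (there L∈) with v , v∈ , refl ← ∈ₚ.∈-map⁻ D L∈ = maxPart-D (∈-elements⁻ v∈)

    maxParts-cover : ∀ {x} → x ∈ upper → ∃ λ L → L ∈ˡ maxParts × x ∈ L
    maxParts-cover x∈ with acSet-elim x∈
    ... | inj₁ refl = _ , here refl , a∈acSet
    ... | inj₂ (i , i<j+1 , v , v∈ , v≥x) with toℕ i ℕₚ.<? toℕ j
    ...   | yes i<j = _ , here refl , acSet-intro v∈ i<j v≥x
    ...   | no i≮j
          with refl ← Finₚ.toℕ-injective (ℕₚ.≤-antisym (ℕₚ.≤-pred i<j+1) (ℕₚ.≮⇒≥ i≮j)) =
      D v , there (∈ₚ.∈-map⁺ D (∈-elements⁺ v∈)) , D⊆acSet v≥x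

  maxPartCount : ∀ a → Fin (suc (k a)) → ℕ
  maxPartCount a zero    = 0
  maxPartCount a (suc j) = suc (length (elements (S a j)))

  acSet-maxParts : ∀ a (t : Fin (suc (k a))) →
                   HasSize G (MaxPart G (AC G k S) (acSet a (toℕ t))) (maxPartCount a t)
  acSet-maxParts a zero =
    subst (λ M → HasSize G (MaxPart G (AC G k S) M) 0) (sym acSet-zero) singleton-maxParts
  acSet-maxParts a (suc j) =
    subst (HasSize G _) (cong suc (Listₚ.length-map D (elements (S a j))))
          (maxParts-enumerated (maxParts-unique a j) (maxParts-maximal a j) (maxParts-cover a j))

  widestLevel : ∀ a → ∃ λ t → ∀ u → maxPartCount a u ≤ maxPartCount a t
  widestLevel a = argmax-Fin (maxPartCount a) zero

  widest : ∃ λ a → ∃ λ t → ∀ b u → maxPartCount b u ≤ maxPartCount a t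
  widest with a , a-best ← argmax-Fin (λ b → maxPartCount b (proj₁ (widestLevel b))) s =
    a , proj₁ (widestLevel a) , λ b u → ℕₚ.≤-trans (proj₂ (widestLevel b) u) (a-best b)

  AC-width : ∀ {a t} → (∀ b u → maxPartCount b u ≤ maxPartCount a t) →
             Width G (AC G k S) (maxPartCount a t)
  AC-width {a} {t} isWidest = bounded , acSet a (toℕ t) , acSet∈AC (Finₚ.toℕ≤pred[n] t) , acSet-maxParts a t
    where
    bounded : ∀ M → AC G k S M → ∃ λ c → HasSize G (MaxPart G (AC G k S) M) c × c ≤ maxPartCount a t
    bounded M M∈AC with b , u , refl ← AC⇒acSet M∈AC = maxPartCount b u , acSet-maxParts b u , isWidest b u

  module _ {F : Family G} (nd : IsNestingDecomposition G F) (a : Fin n) (j : Fin (k a)) where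
    open IsNestingDecomposition nd
    open MaximalParts G nd using (maxPart-containing)

    Meets : Subset n → Set
    Meets K = F K × a ∈ K × ∃ λ x → x ∈ K × InDS G (S a j) x

    -- a and the nodes of S a j lie in distinct maximal parts of a minimal such M: a part holding a
    -- and some w ∈ S a j would itself satisfy Meets, and a module avoiding a holds at most one child of a.
    minimal⇒maxParts≥ : Meets M → (∀ {K} → Meets K → ¬ K ⊂ M) →
                       ∀ {xs} → (∀ H → H ∈ˡ xs ⇔ MaxPart G F M H) →
                       suc (length (elements (S a j))) ≤ length xs
    minimal⇒maxParts≥ {M} (FM , a∈M , x , x∈M , v , v∈ , v≥x) minimal {xs} enum =
      length-≤-by-injection xs unique inPart injective
      where
      PartOf : Fin n → Subset n → Set
      PartOf y H = MaxPart G F M H × y ∈ H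

      unique : Unique (a ∷ elements (S a j))
      unique = All.tabulate (λ w∈ a≡w → proj₂ (proj₁ (scc⇒⋗ (∈-elements⁻ w∈))) a≡w)
               ∷ elements-unique (S a j)

      part : y ∈ M → w ∈ M → y ≢ w → ∃ λ H → H ∈ˡ xs × PartOf y H
      part y∈M w∈M y≢w with H , H-max , y∈H ← maxPart-containing enum y∈M w∈M y≢w =
        H , from (enum H) H-max , H-max , y∈H

      inPart : y ∈ˡ a ∷ elements (S a j) → ∃ λ H → H ∈ˡ xs × PartOf y H
      inPart (here refl) = part a∈M x∈M (proj₂ (⋗-≥ₛ (scc⇒⋗ v∈) v≥x))
      inPart (there w∈)  = part (module⊇scc (modules M FM) a∈M x∈M v∈ v≥x (∈-elements⁻ w∈)) a∈M
                               (λ w≡a → proj₂ (proj₁ (scc⇒⋗ (∈-elements⁻ w∈))) (sym w≡a))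

      noMeet : ∀ {H} → MaxPart G F M H → a ∈ H → w ∈ S a j → w ∈ H → ⊥
      noMeet (FH , H⊂M , _) a∈H w∈ w∈H = minimal (FH , a∈H , _ , w∈H , _ , w∈ , ≥ₛ-refl) H⊂M

      injective : ∀ {y y′ H} → y ∈ˡ a ∷ elements (S a j) → y′ ∈ˡ a ∷ elements (S a j) →
                  PartOf y H → PartOf y′ H → y ≡ y′
      injective (here refl) (here refl) _ _ = refl
      injective (here refl) (there w∈) (H-max , a∈H) (_ , w∈H) =
        ⊥-elim (noMeet H-max a∈H (∈-elements⁻ w∈) w∈H)
      injective (there w∈) (here refl) (H-max , w∈H) (_ , a∈H) =
        ⊥-elim (noMeet H-max a∈H (∈-elements⁻ w∈) w∈H)
      injective (there w∈) (there w′∈) (H-max , w∈H) (_ , w′∈H) =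
        trans (sym (entry-child md a∉H (scc⇒⋗ (∈-elements⁻ w∈)) w∈H))
              (entry-child md a∉H (scc⇒⋗ (∈-elements⁻ w′∈)) w′∈H)
        where
        md  = modules _ (proj₁ H-max)
        a∉H = λ a∈H → noMeet H-max a∈H (∈-elements⁻ w∈) w∈H

    ∣scc∣<width : ∀ {w} → Width G F w → length (elements (S a j)) < w
    ∣scc∣<width {w} (bounded , _) = decidable-stable (_ ℕₚ.≤? w) λ ≰ →
      wf-minimal ⊂-wellFounded {P = Meets} meets⊤ λ (M , meetsM , minimal) →
        let _ , (xs , _ , |xs|≡c , enum) , c≤w = bounded M (proj₁ meetsM)
        in ≰ (ℕₚ.≤-trans (minimal⇒maxParts≥ meetsM minimal enum)
                         (ℕₚ.≤-trans (ℕₚ.≤-reflexive |xs|≡c) c≤w))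
      where
      meets⊤ : Meets ⊤
      meets⊤ with r , r∈ ← scc-inhabited a j =
        hasTrivial ⊤ (inj₁ refl) , Subsetₚ.∈⊤ , r , Subsetₚ.∈⊤ , r , r∈ , ≥ₛ-refl

  maxPartCount≤width : ∀ {F w} → IsNestingDecomposition G F → Width G F w → ∀ a t → maxPartCount a t ≤ w
  maxPartCount≤width nd width a zero    = z≤n
  maxPartCount≤width nd width a (suc j) = ∣scc∣<width nd a j width

  AC-minimumWidth : ∃ λ w → Width G (AC G k S) w × NestingWidth G w
  AC-minimumWidth with a , t , isWidest ← widest =
    maxPartCount a t , AC-width isWidest ,
    (AC G k S , AC-isNestingDecomposition , AC-width isWidest) ,
    λ _ _ nd width → maxPartCount≤width nd width a t

theorem1 : (G : Graph) → AllReachable G →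
           (k : Fin (Graph.n G) → ℕ) (S : (a : Fin (Graph.n G)) → Fin (k a) → Subset (Graph.n G)) →
           IsACTree G k S →
           IsNestingDecomposition G (AC G k S) ×
           (∃ λ w → Width G (AC G k S) w × NestingWidth G w)
theorem1 G reach k S T = AC-isNestingDecomposition , AC-minimumWidth
  where open ACTree G reach k S T
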